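{- Let $a$ be a positive integer and let $f(x)$ be one of the polynomials $x^2-ax-1$, $x^3+ax+1$, $x^3+x^2+ax+1$, where in the last case $a\geq 3$. Then for every $g\in\mathbb{Z}[x]$ which is not identically zero, $L(fg)\geq L(f)$.
   Context: For an integer polynomial $g(x)=b_mx^m+\dots+b_0$, its length is $L(g)=|b_m|+\dots+|b_0|$. -}

module Defs where

open import Data.Nat using (ℕ; suc; _≤_)
open import Data.Integer as ℤ using (ℤ; +_; -_; ∣_∣; 0ℤ)
open import Data.List using (List; []; _∷_; map)
open import Data.Nat.ListAction using (sum)
open import Data.List.Relation.Unary.Any using (Any)
open import Relation.Binary.PropositionalEquality using (_≢_)

-- An integer polynomial b₀ + b₁ x + … + bₘ xᵐ is represented by its
-- coefficient list [b₀, b₁, …, bₘ] (lowest degree first). Trailing zeros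
-- are allowed; they do not affect the polynomial, its length, or the product.
Poly : Set
Poly = List ℤ

_⊕_ : Poly → Poly → Poly
[] ⊕ q = q
(a ∷ p) ⊕ [] = a ∷ p
(a ∷ p) ⊕ (b ∷ q) = (a ℤ.+ b) ∷ (p ⊕ q)

_⊛_ : Poly → Poly → Poly
[] ⊛ q = []
(a ∷ p) ⊛ q = map (a ℤ.*_) q ⊕ (0ℤ ∷ (p ⊛ q))

L : Poly → ℕ
L p = sum (map ∣_∣ p)

NonZeroPoly : Poly → Set
NonZeroPoly p = Any (λ c → c ≢ 0ℤ) p

f₁ : ℕ → Poly
f₁ a = ℤ.- (+ 1) ∷ ℤ.- (+ a) ∷ + 1 ∷ []

f₂ : ℕ → Poly
f₂ a = + 1 ∷ + a ∷ + 0 ∷ + 1 ∷ []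

f₃ : ℕ → Poly
f₃ a = + 1 ∷ + a ∷ + 1 ∷ + 1 ∷ []

module Submission where

-- All three polynomials are handled as cubics c₀ + c₁x + c₂x² + c₃x³; the
-- quadratic is padded with c₃ = 0, which only appends zero coefficients to
-- fg (L-pad).  The product f·g is produced by streaming the coefficients of
-- g through a window (p, q, r) holding the three coefficients read last:
-- reading x emits c₀x + c₁p + c₂q + c₃r, and at the end the window flushes
-- three more coefficients (module Cubic).  Two arguments bound the length of
-- the emitted stream.
--
-- * Dominant linear coefficient (a ≥ 2, resp. a ≥ 3 for the last cubic).
--   For every cubic with |c₁| ≥ |c₀| + |c₂| + |c₃|, the triangle inequality
--   at each emitted coefficient propagates a linear lower bound for the rest
--   of the stream in terms of the window (Cubic.Dominant).
-- * Alternating signs (a = 1).  For x² − x − 1 and x³ + x + 1, a window whose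
--   entries alternate in sign can emit a zero only by moving to another such
--   window, and a window with a nonzero entry always emits a nonzero
--   coefficient later; hence such windows emit length ≥ 2, and
--   L(fg) ≥ 1 + 2 = L(f) (Cubic.SignInvariant, instances Golden, Trinomial).

open import Data.Empty using (⊥; ⊥-elim)
open import Data.Integer as ℤ using (ℤ; +_; 0ℤ; ∣_∣)
import Data.Integer.Properties as ℤP
import Data.Integer.Tactic.RingSolver as ℤSolver
open import Data.List using ([]; _∷_; map; _++_)
open import Data.List.Relation.Unary.All as All using (All)
open import Data.List.Relation.Unary.Any using (here; there)
open import Data.List.Membership.Propositional using (_∈_)
open import Data.Nat using (ℕ; suc; _+_; _*_; _∸_; _≤_; _≥_; z≤n; s≤s)
open import Data.Nat.Properties
  using ( n≢0⇒n>0; m≤m+n; m≤n+m; m+[n∸m]≡n; ≤-trans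
        ; +-assoc; +-mono-≤; +-monoˡ-≤; +-monoʳ-≤; +-cancelʳ-≤
        ; *-monoʳ-≤; *-identityʳ; *-distribʳ-+; module ≤-Reasoning )
open import Data.Nat.Tactic.RingSolver using (solve)
open import Data.Product using (∃; _×_; _,_)
open import Data.Sum using (_⊎_; inj₁; inj₂)
open import Relation.Binary.Definitions using (tri<; tri≈; tri>)
open import Relation.Nullary using (yes; no)
open import Relation.Binary.PropositionalEquality
  using (_≡_; _≢_; refl; sym; trans; cong; cong₂; subst; subst₂; module ≡-Reasoning)

open import Defs

abs-pos : ∀ {i} → i ≢ 0ℤ → 1 ≤ ∣ i ∣
abs-pos i≢0 = n≢0⇒n>0 (λ ∣i∣≡0 → i≢0 (ℤP.∣i∣≡0⇒i≡0 ∣i∣≡0))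

pos⇒≢0 : ∀ {i} → 0ℤ ℤ.< i → i ≢ 0ℤ
pos⇒≢0 0<i i≡0 = ℤP.<⇒≢ 0<i (sym i≡0)

neg⇒≢0 : ∀ {i} → i ℤ.< 0ℤ → i ≢ 0ℤ
neg⇒≢0 = ℤP.<⇒≢

∣i∣≤∣i+j∣+∣j∣ : ∀ i j → ∣ i ∣ ≤ ∣ i ℤ.+ j ∣ + ∣ j ∣
∣i∣≤∣i+j∣+∣j∣ i j =
  subst (λ k → ∣ k ∣ ≤ ∣ i ℤ.+ j ∣ + ∣ j ∣) i+j-j≡i (ℤP.∣i-j∣≤∣i∣+∣j∣ (i ℤ.+ j) j)
  where
  open ≡-Reasoning
  i+j-j≡i : (i ℤ.+ j) ℤ.- j ≡ i
  i+j-j≡i = begin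
    (i ℤ.+ j) ℤ.- j   ≡⟨ ℤP.+-assoc i j (ℤ.- j) ⟩
    i ℤ.+ (j ℤ.- j)   ≡⟨ cong (ℤ._+_ i) (ℤP.+-inverseʳ j) ⟩
    i ℤ.+ 0ℤ          ≡⟨ ℤP.+-identityʳ i ⟩
    i                 ∎

∣j∣≤∣i+j∣+∣i∣ : ∀ i j → ∣ j ∣ ≤ ∣ i ℤ.+ j ∣ + ∣ i ∣
∣j∣≤∣i+j∣+∣i∣ i j = subst (λ k → ∣ j ∣ ≤ ∣ k ∣ + ∣ i ∣) (ℤP.+-comm j i) (∣i∣≤∣i+j∣+∣j∣ j i)

≡-≢0 : ∀ {a b} → a ≡ b → b ≢ 0ℤ → a ≢ 0ℤ
≡-≢0 a≡b b≢0 a≡0 = b≢0 (trans (sym a≡b) a≡0)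

*-≢0 : ∀ {c z} → c ≢ 0ℤ → z ≢ 0ℤ → c ℤ.* z ≢ 0ℤ
*-≢0 {c} c≢0 z≢0 cz≡0 with ℤP.i*j≡0⇒i≡0∨j≡0 c cz≡0
... | inj₁ c≡0 = c≢0 c≡0
... | inj₂ z≡0 = z≢0 z≡0

skip : ∀ c y → c ℤ.* 0ℤ ℤ.+ y ≡ y
skip c y = trans (cong (ℤ._+ y) (ℤP.*-zeroʳ c)) (ℤP.+-identityˡ y)

Zeros : Poly → Set
Zeros = All (_≡ 0ℤ)

L-zeros : ∀ {z} → Zeros z → L z ≡ 0
L-zeros All.[]          = refl
L-zeros (refl All.∷ zs) = L-zeros zs

zeros-or-nonzero : ∀ g → Zeros g ⊎ NonZeroPoly g
zeros-or-nonzero [] = inj₁ All.[]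
zeros-or-nonzero (x ∷ g) with x ℤ.≟ 0ℤ | zeros-or-nonzero g
... | no x≢0   | _        = inj₂ (here x≢0)
... | yes x≡0  | inj₁ zs  = inj₁ (x≡0 All.∷ zs)
... | yes _    | inj₂ g≢0 = inj₂ (there g≢0)

zeros-not-nonzero : ∀ {g} → Zeros g → NonZeroPoly g → ⊥
zeros-not-nonzero (refl All.∷ _)  (here 0≢0)  = 0≢0 refl
zeros-not-nonzero (_    All.∷ zs) (there g≢0) = zeros-not-nonzero zs g≢0

head-nonzero : ∀ {x g} → NonZeroPoly (x ∷ g) → Zeros g → x ≢ 0ℤ
head-nonzero (here x≢0)  _  = x≢0
head-nonzero (there g≢0) zs = ⊥-elim (zeros-not-nonzero zs g≢0)

drop-zero : ∀ {g} → NonZeroPoly (0ℤ ∷ g) → NonZeroPoly g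
drop-zero (here 0≢0)  = ⊥-elim (0≢0 refl)
drop-zero (there g≢0) = g≢0

L-tail : ∀ x u → L u ≤ L (x ∷ u)
L-tail x u = m≤n+m (L u) ∣ x ∣

entry≤L : ∀ {y u} → y ∈ u → ∣ y ∣ ≤ L u
entry≤L {u = _ ∷ u} (here refl)  = m≤m+n _ (L u)
entry≤L {u = x ∷ u} (there y∈u) = ≤-trans (entry≤L y∈u) (L-tail x u)

nonzero-entry : ∀ u {y} → y ∈ u → y ≢ 0ℤ → 1 ≤ L u
nonzero-entry _ y∈u y≢0 = ≤-trans (abs-pos y≢0) (entry≤L y∈u)

⊕-identityʳ : ∀ u → u ⊕ [] ≡ u
⊕-identityʳ []      = refl
⊕-identityʳ (_ ∷ _) = refl

⊕-assoc : ∀ u v w → (u ⊕ v) ⊕ w ≡ u ⊕ (v ⊕ w)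
⊕-assoc []      v       w       = refl
⊕-assoc (a ∷ u) []      w       = refl
⊕-assoc (a ∷ u) (b ∷ v) []      = refl
⊕-assoc (a ∷ u) (b ∷ v) (c ∷ w) = cong₂ _∷_ (ℤP.+-assoc a b c) (⊕-assoc u v w)

⊕-zeros : ∀ {u v} → Zeros u → Zeros v → Zeros (u ⊕ v)
⊕-zeros All.[]          zv              = zv
⊕-zeros (refl All.∷ zu) All.[]          = refl All.∷ zu
⊕-zeros (refl All.∷ zu) (refl All.∷ zv) = refl All.∷ ⊕-zeros zu zv

L-⊕-zeros : ∀ u {z} → Zeros z → L (u ⊕ z) ≡ L u
L-⊕-zeros []      zs              = L-zeros zs
L-⊕-zeros (a ∷ u) All.[]          = refl
L-⊕-zeros (a ∷ u) (refl All.∷ zs) = cong₂ _+_ (cong ∣_∣ (ℤP.+-identityʳ a)) (L-⊕-zeros u zs)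

⊛-pad : ∀ f g → ∃ λ z → Zeros z × (f ++ 0ℤ ∷ []) ⊛ g ≡ (f ⊛ g) ⊕ z
⊛-pad [] g = map (0ℤ ℤ.*_) g ⊕ (0ℤ ∷ []) , ⊕-zeros (zero-multiples g) (refl All.∷ All.[]) , refl
  where
  zero-multiples : ∀ g → Zeros (map (0ℤ ℤ.*_) g)
  zero-multiples []      = All.[]
  zero-multiples (_ ∷ g) = refl All.∷ zero-multiples g
⊛-pad (c ∷ f) g with ⊛-pad f g
... | z , zs , eq = 0ℤ ∷ z , refl All.∷ zs , (begin
  map (c ℤ.*_) g ⊕ (0ℤ ∷ ((f ++ 0ℤ ∷ []) ⊛ g))
    ≡⟨ cong (λ h → map (c ℤ.*_) g ⊕ (0ℤ ∷ h)) eq ⟩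
  map (c ℤ.*_) g ⊕ ((0ℤ ∷ (f ⊛ g)) ⊕ (0ℤ ∷ z))
    ≡⟨ ⊕-assoc (map (c ℤ.*_) g) (0ℤ ∷ (f ⊛ g)) (0ℤ ∷ z) ⟨
  ((c ∷ f) ⊛ g) ⊕ (0ℤ ∷ z) ∎)
  where open ≡-Reasoning

L-pad : ∀ f g → L ((f ++ 0ℤ ∷ []) ⊛ g) ≡ L (f ⊛ g)
L-pad f g with ⊛-pad f g
... | z , zs , eq = trans (cong L eq) (L-⊕-zeros (f ⊛ g) zs)

L-scale : ∀ f x → L (map (ℤ._* x) f) ≡ L f * ∣ x ∣
L-scale []      x = refl
L-scale (c ∷ f) x =
  trans (cong₂ _+_ (ℤP.abs-* c x) (L-scale f x)) (sym (*-distribʳ-+ ∣ x ∣ ∣ c ∣ (L f)))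

-- The weights
-- a₀ … a₃ stand for |c₀| … |c₃| with a₁ = a₀ + a₂ + a₃ + K; P, Q, R are the
-- window entries, X the coefficient read, O the emitted coefficient.

-- Propagating the invariant through one emitted coefficient.
step-arith : ∀ {K a₀ a₁ a₂ a₃ C X P Q R O T} → a₁ ≡ a₀ + a₂ + a₃ + K
  → (K + a₀) * X + C ≤ T + ((a₂ + a₃) * P + a₃ * Q)
  → a₁ * P ≤ O + a₀ * X + a₂ * Q + a₃ * R
  → (K + a₀) * P + C ≤ O + T + ((a₂ + a₃) * Q + a₃ * R)
step-arith {K} {a₀} {_} {a₂} {a₃} {C} {X} {P} {Q} {R} {O} {T} refl rest emit =
  +-cancelʳ-≤ ((a₂ + a₃) * P + a₀ * X) _ _ (begin
    (K + a₀) * P + C + ((a₂ + a₃) * P + a₀ * X)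
      ≤⟨ m≤m+n _ (K * X) ⟩
    (K + a₀) * P + C + ((a₂ + a₃) * P + a₀ * X) + K * X
      ≡⟨ solve (K ∷ a₀ ∷ a₂ ∷ a₃ ∷ C ∷ X ∷ P ∷ []) ⟩
    ((K + a₀) * X + C) + (a₀ + a₂ + a₃ + K) * P
      ≤⟨ +-mono-≤ rest emit ⟩
    (T + ((a₂ + a₃) * P + a₃ * Q)) + (O + a₀ * X + a₂ * Q + a₃ * R)
      ≡⟨ solve (a₀ ∷ a₂ ∷ a₃ ∷ X ∷ P ∷ Q ∷ R ∷ O ∷ T ∷ []) ⟩
    O + T + ((a₂ + a₃) * Q + a₃ * R) + ((a₂ + a₃) * P + a₀ * X) ∎)
  where open ≤-Reasoning

-- The last nonzero coefficient X of g and the final flush.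
end-arith : ∀ {K a₀ a₁ a₂ a₃ X P Q R O U V} → a₁ ≡ a₀ + a₂ + a₃ + K → 1 ≤ X
  → a₁ * P ≤ O + a₀ * X + a₂ * Q + a₃ * R
  → a₁ * X ≤ U + a₂ * P + a₃ * Q
  → a₂ * X ≤ V + a₃ * P
  → (K + a₀) * P + 2 * (a₂ + a₃) ≤ O + (U + (V + (a₃ * X + 0))) + ((a₂ + a₃) * Q + a₃ * R)
end-arith {K} {a₀} {_} {a₂} {a₃} {X} {P} {Q} {R} {O} {U} {V} refl 1≤X emit carry₁ carry₂ =
  +-cancelʳ-≤ ((a₂ + a₃) * P + (a₀ + a₂ + a₂ + a₃) * X) _ _ (begin
    (K + a₀) * P + 2 * (a₂ + a₃) + ((a₂ + a₃) * P + (a₀ + a₂ + a₂ + a₃) * X)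
      ≤⟨ m≤m+n _ (K * X) ⟩
    (K + a₀) * P + 2 * (a₂ + a₃) + ((a₂ + a₃) * P + (a₀ + a₂ + a₂ + a₃) * X) + K * X
      ≡⟨ solve (K ∷ a₀ ∷ a₂ ∷ a₃ ∷ X ∷ P ∷ []) ⟩
    (a₀ + a₂ + a₃ + K) * P + (a₀ + a₂ + a₃ + K) * X + a₂ * X + 2 * (a₂ + a₃) * 1
      ≤⟨ +-mono-≤ (+-mono-≤ (+-mono-≤ emit carry₁) carry₂) (*-monoʳ-≤ (2 * (a₂ + a₃)) 1≤X) ⟩
    (O + a₀ * X + a₂ * Q + a₃ * R) + (U + a₂ * P + a₃ * Q) + (V + a₃ * P) + 2 * (a₂ + a₃) * X
      ≡⟨ solve (a₀ ∷ a₂ ∷ a₃ ∷ X ∷ P ∷ Q ∷ R ∷ O ∷ U ∷ V ∷ []) ⟩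
    O + (U + (V + (a₃ * X + 0))) + ((a₂ + a₃) * Q + a₃ * R)
      + ((a₂ + a₃) * P + (a₀ + a₂ + a₂ + a₃) * X) ∎)
  where open ≤-Reasoning

-- The first nonzero coefficient X of g, followed by a nonzero tail.
start-arith : ∀ {K a₀ a₁ a₂ a₃ X T} → a₁ ≡ a₀ + a₂ + a₃ + K → 1 ≤ X
  → (K + a₀) * X + 2 * (a₂ + a₃) ≤ T + ((a₂ + a₃) * 0 + a₃ * 0)
  → a₀ + (a₁ + (a₂ + (a₃ + 0))) ≤ a₀ * X + T
start-arith {K} {a₀} {_} {a₂} {a₃} {X} {T} refl 1≤X rest = begin
  a₀ + (a₀ + a₂ + a₃ + K + (a₂ + (a₃ + 0)))
    ≡⟨ solve (K ∷ a₀ ∷ a₂ ∷ a₃ ∷ []) ⟩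
  a₀ * 1 + ((K + a₀) * 1 + 2 * (a₂ + a₃))
    ≤⟨ +-mono-≤ (*-monoʳ-≤ a₀ 1≤X) (+-monoˡ-≤ _ (*-monoʳ-≤ (K + a₀) 1≤X)) ⟩
  a₀ * X + ((K + a₀) * X + 2 * (a₂ + a₃))
    ≤⟨ +-monoʳ-≤ (a₀ * X) rest ⟩
  a₀ * X + (T + ((a₂ + a₃) * 0 + a₃ * 0))
    ≡⟨ solve (a₀ ∷ a₂ ∷ a₃ ∷ X ∷ T ∷ []) ⟩
  a₀ * X + T ∎
  where open ≤-Reasoning

module Cubic (c₀ c₁ c₂ c₃ : ℤ) where

  cubic : Poly
  cubic = c₀ ∷ c₁ ∷ c₂ ∷ c₃ ∷ []

  α₀ α₁ α₂ α₃ : ℕ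
  α₀ = ∣ c₀ ∣
  α₁ = ∣ c₁ ∣
  α₂ = ∣ c₂ ∣
  α₃ = ∣ c₃ ∣

  -- Contributions of the window (p, q, r) (newest first) to the next two
  -- coefficients of the product.
  carry₂ : ℤ → ℤ → ℤ
  carry₂ p q = c₂ ℤ.* p ℤ.+ c₃ ℤ.* q

  carry₁ : ℤ → ℤ → ℤ → ℤ
  carry₁ p q r = c₁ ℤ.* p ℤ.+ carry₂ q r

  stream : ℤ → ℤ → ℤ → Poly → Poly
  stream p q r []      = carry₁ p q r ∷ carry₂ p q ∷ c₃ ℤ.* p ∷ []
  stream p q r (x ∷ g) = c₀ ℤ.* x ℤ.+ carry₁ p q r ∷ stream x p q g

  carry₂-zero : carry₂ 0ℤ 0ℤ ≡ 0ℤ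
  carry₂-zero = cong₂ ℤ._+_ (ℤP.*-zeroʳ c₂) (ℤP.*-zeroʳ c₃)

  carry₁-zero : carry₁ 0ℤ 0ℤ 0ℤ ≡ 0ℤ
  carry₁-zero = cong₂ ℤ._+_ (ℤP.*-zeroʳ c₁) carry₂-zero

  -- The form in which _⊛_ unfolds cubic ⊛ g, with the values u, v, w in
  -- place of the zeros that shift the partial products.
  shape : ℤ → ℤ → ℤ → Poly → Poly
  shape u v w g =
    map (c₀ ℤ.*_) g ⊕ (u ∷ (map (c₁ ℤ.*_) g ⊕ (v ∷ (map (c₂ ℤ.*_) g ⊕ (w ∷ map (c₃ ℤ.*_) g)))))

  shape-stream : ∀ p q r g → shape (carry₁ p q r) (carry₂ p q) (c₃ ℤ.* p) g ≡ stream p q r g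
  shape-stream p q r []      = refl
  shape-stream p q r (x ∷ g) = cong (c₀ ℤ.* x ℤ.+ carry₁ p q r ∷_) (shape-stream x p q g)

  product-stream : ∀ x g → cubic ⊛ (x ∷ g) ≡ stream 0ℤ 0ℤ 0ℤ (x ∷ g)
  product-stream x g = begin
    cubic ⊛ (x ∷ g)
      ≡⟨ cong (λ t → map (c₀ ℤ.*_) (x ∷ g) ⊕ (0ℤ ∷ (map (c₁ ℤ.*_) (x ∷ g)
                       ⊕ (0ℤ ∷ (map (c₂ ℤ.*_) (x ∷ g) ⊕ (0ℤ ∷ t))))))
              (cong₂ _∷_ (ℤP.+-identityʳ (c₃ ℤ.* x)) (⊕-identityʳ (map (c₃ ℤ.*_) g))) ⟩
    shape 0ℤ 0ℤ 0ℤ (x ∷ g)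
      ≡⟨ cong₂ (λ u v → shape u v 0ℤ (x ∷ g)) carry₁-zero carry₂-zero ⟨
    shape (carry₁ 0ℤ 0ℤ 0ℤ) (carry₂ 0ℤ 0ℤ) 0ℤ (x ∷ g)
      ≡⟨ cong (λ w → shape (carry₁ 0ℤ 0ℤ 0ℤ) (carry₂ 0ℤ 0ℤ) w (x ∷ g)) (ℤP.*-zeroʳ c₃) ⟨
    shape (carry₁ 0ℤ 0ℤ 0ℤ) (carry₂ 0ℤ 0ℤ) (c₃ ℤ.* 0ℤ) (x ∷ g)
      ≡⟨ shape-stream 0ℤ 0ℤ 0ℤ (x ∷ g) ⟩
    stream 0ℤ 0ℤ 0ℤ (x ∷ g) ∎
    where open ≡-Reasoning

  emitted-later : ∀ p q r x g → L (stream x p q g) ≤ L (stream p q r (x ∷ g))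
  emitted-later p q r x g = L-tail (c₀ ℤ.* x ℤ.+ carry₁ p q r) (stream x p q g)

  -- Leading zeros of g only shift the product, so a lower bound for L(fg)
  -- follows from one for the stream after the first nonzero coefficient x,
  -- which is emitted as c₀x.
  lower-bound : (B : ℕ) → (∀ x g → x ≢ 0ℤ → B ≤ α₀ * ∣ x ∣ + L (stream x 0ℤ 0ℤ g))
              → ∀ g → NonZeroPoly g → B ≤ L (cubic ⊛ g)
  lower-bound B bound (x ∷ g) g≢0 =
    subst (λ h → B ≤ L h) (sym (product-stream x g)) (from-empty (x ∷ g) g≢0)
    where
    first-emitted : ∀ x → ∣ c₀ ℤ.* x ℤ.+ carry₁ 0ℤ 0ℤ 0ℤ ∣ ≡ α₀ * ∣ x ∣
    first-emitted x = trans (cong (λ t → ∣ c₀ ℤ.* x ℤ.+ t ∣) carry₁-zero)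
                            (trans (cong ∣_∣ (ℤP.+-identityʳ (c₀ ℤ.* x))) (ℤP.abs-* c₀ x))

    from-empty : ∀ g → NonZeroPoly g → B ≤ L (stream 0ℤ 0ℤ 0ℤ g)
    from-empty (x ∷ g) g≢0 with x ℤ.≟ 0ℤ
    ... | no x≢0  = subst (λ e → B ≤ e + L (stream x 0ℤ 0ℤ g)) (sym (first-emitted x)) (bound x g x≢0)
    ... | yes refl = ≤-trans (from-empty g (drop-zero g≢0)) (emitted-later 0ℤ 0ℤ 0ℤ 0ℤ g)

  read-zero : ∀ p q r → L (stream p q r (0ℤ ∷ [])) ≡ L (stream p q r [])
  read-zero p q r =
    cong₂ _+_ (cong ∣_∣ (skip c₀ _))
      (cong₂ _+_ (cong ∣_∣ (skip c₁ _))
        (cong₂ _+_ (cong ∣_∣ (skip c₂ _)) (cong (λ t → ∣ t ∣ + 0) (ℤP.*-zeroʳ c₃))))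

  stream-zeros : ∀ p q r {g} → Zeros g → L (stream p q r g) ≡ L (stream p q r [])
  stream-zeros p q r All.[]          = refl
  stream-zeros p q r (refl All.∷ zs) =
    trans (cong (_+_ ∣ c₀ ℤ.* 0ℤ ℤ.+ carry₁ p q r ∣) (stream-zeros 0ℤ p q zs)) (read-zero p q r)

  -- For g = x a single coefficient the product is x·f.
  monomial-bound : ∀ x → x ≢ 0ℤ → L cubic ≤ α₀ * ∣ x ∣ + L (stream x 0ℤ 0ℤ [])
  monomial-bound x x≢0 = begin
    L cubic                             ≡⟨ *-identityʳ (L cubic) ⟨
    L cubic * 1                         ≤⟨ *-monoʳ-≤ (L cubic) (abs-pos x≢0) ⟩
    L cubic * ∣ x ∣                     ≡⟨ L-scale cubic x ⟨
    L (map (ℤ._* x) cubic)              ≡⟨ cong₂ _+_ (ℤP.abs-* c₀ x) (cong L flush) ⟩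
    α₀ * ∣ x ∣ + L (stream x 0ℤ 0ℤ [])  ∎
    where
    open ≤-Reasoning
    flush : map (ℤ._* x) (c₁ ∷ c₂ ∷ c₃ ∷ []) ≡ stream x 0ℤ 0ℤ []
    flush = sym (cong₂ _∷_ (trans (cong (ℤ._+_ (c₁ ℤ.* x)) carry₂-zero) (ℤP.+-identityʳ _))
                  (cong₂ _∷_ (trans (cong (ℤ._+_ (c₂ ℤ.* x)) (ℤP.*-zeroʳ c₃)) (ℤP.+-identityʳ _)) refl))

  carry₂-triangle : ∀ q r → ∣ carry₂ q r ∣ ≤ α₂ * ∣ q ∣ + α₃ * ∣ r ∣
  carry₂-triangle q r = subst₂ (λ s t → ∣ carry₂ q r ∣ ≤ s + t) (ℤP.abs-* c₂ q) (ℤP.abs-* c₃ r)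
                          (ℤP.∣i+j∣≤∣i∣+∣j∣ (c₂ ℤ.* q) (c₃ ℤ.* r))

  carry₂-bound : ∀ p q → α₂ * ∣ p ∣ ≤ ∣ carry₂ p q ∣ + α₃ * ∣ q ∣
  carry₂-bound p q = subst₂ (λ s t → s ≤ ∣ carry₂ p q ∣ + t) (ℤP.abs-* c₂ p) (ℤP.abs-* c₃ q)
                       (∣i∣≤∣i+j∣+∣j∣ (c₂ ℤ.* p) (c₃ ℤ.* q))

  carry₁-bound : ∀ p q r → α₁ * ∣ p ∣ ≤ ∣ carry₁ p q r ∣ + α₂ * ∣ q ∣ + α₃ * ∣ r ∣
  carry₁-bound p q r = begin
    α₁ * ∣ p ∣                                     ≡⟨ ℤP.abs-* c₁ p ⟨
    ∣ c₁ ℤ.* p ∣                                   ≤⟨ ∣i∣≤∣i+j∣+∣j∣ (c₁ ℤ.* p) (carry₂ q r) ⟩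
    ∣ carry₁ p q r ∣ + ∣ carry₂ q r ∣              ≤⟨ +-monoʳ-≤ _ (carry₂-triangle q r) ⟩
    ∣ carry₁ p q r ∣ + (α₂ * ∣ q ∣ + α₃ * ∣ r ∣)   ≡⟨ +-assoc ∣ carry₁ p q r ∣ (α₂ * ∣ q ∣) (α₃ * ∣ r ∣) ⟨
    ∣ carry₁ p q r ∣ + α₂ * ∣ q ∣ + α₃ * ∣ r ∣     ∎
    where open ≤-Reasoning

  emit-bound : ∀ x p q r
    → α₁ * ∣ p ∣ ≤ ∣ c₀ ℤ.* x ℤ.+ carry₁ p q r ∣ + α₀ * ∣ x ∣ + α₂ * ∣ q ∣ + α₃ * ∣ r ∣
  emit-bound x p q r = ≤-trans (carry₁-bound p q r) (+-monoˡ-≤ _ (+-monoˡ-≤ _ carry₁≤))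
    where
    carry₁≤ : ∣ carry₁ p q r ∣ ≤ ∣ c₀ ℤ.* x ℤ.+ carry₁ p q r ∣ + α₀ * ∣ x ∣
    carry₁≤ = subst (λ t → ∣ carry₁ p q r ∣ ≤ ∣ c₀ ℤ.* x ℤ.+ carry₁ p q r ∣ + t) (ℤP.abs-* c₀ x)
                (∣j∣≤∣i+j∣+∣i∣ (c₀ ℤ.* x) (carry₁ p q r))

  module Dominant (K : ℕ) (excess : α₁ ≡ α₀ + α₂ + α₃ + K) where

    -- What the older window entries q, r may still cancel later.
    debt : ℤ → ℤ → ℕ
    debt q r = (α₂ + α₃) * ∣ q ∣ + α₃ * ∣ r ∣

    invariant : ∀ p q r g → NonZeroPoly g
              → (K + α₀) * ∣ p ∣ + 2 * (α₂ + α₃) ≤ L (stream p q r g) + debt q r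
    invariant p q r (x ∷ g) x∷g≢0 with zeros-or-nonzero g
    ... | inj₂ g≢0 = step-arith {K} {α₀} {α₁} {α₂} {α₃} excess (invariant x p q g g≢0) (emit-bound x p q r)
    ... | inj₁ g≡0 rewrite stream-zeros x p q g≡0 | ℤP.abs-* c₃ x =
      end-arith {K} {α₀} {α₁} {α₂} {α₃} excess (abs-pos (head-nonzero x∷g≢0 g≡0))
        (emit-bound x p q r) (carry₁-bound x p q) (carry₂-bound x p)

    -- From the first nonzero coefficient x: either x is the only one and the
    -- product is x·f, or the invariant for the window (x, 0, 0) applies.
    theorem : ∀ g → NonZeroPoly g → L cubic ≤ L (cubic ⊛ g)
    theorem = lower-bound (L cubic) start
      where
      start : ∀ x g → x ≢ 0ℤ → L cubic ≤ α₀ * ∣ x ∣ + L (stream x 0ℤ 0ℤ g)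
      start x g x≢0 with zeros-or-nonzero g
      ... | inj₁ g≡0 rewrite stream-zeros x 0ℤ 0ℤ g≡0 = monomial-bound x x≢0
      ... | inj₂ g≢0 = start-arith {K} {α₀} {α₁} {α₂} {α₃} excess (abs-pos x≢0) (invariant x 0ℤ 0ℤ g g≢0)

  -- A window containing a nonzero entry keeps the stream nonzero, provided
  -- the top coefficient of f reaches that entry.

  nonzero-stream : (W : ℤ → ℤ → ℤ → Set)
    → (∀ {p q r} → W p q r → 1 ≤ L (stream p q r []))
    → (∀ x {p q r} → W p q r → W x p q ⊎ c₀ ℤ.* x ℤ.+ carry₁ p q r ≢ 0ℤ)
    → ∀ {p q r} g → W p q r → 1 ≤ L (stream p q r g)
  nonzero-stream W flush read []      w = flush w
  nonzero-stream W flush read {p} {q} {r} (x ∷ g) w with read x w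
  ... | inj₁ w′  = ≤-trans (nonzero-stream W flush read g w′) (emitted-later p q r x g)
  ... | inj₂ o≢0 = nonzero-entry (stream p q r (x ∷ g)) (here refl) o≢0

  -- For a genuine cubic every nonzero window entry eventually meets c₃.
  module TopCubic (c₃≢0 : c₃ ≢ 0ℤ) where
    data Live : ℤ → ℤ → ℤ → Set where
      newest : ∀ {p q r} → p ≢ 0ℤ → Live p q r
      middle : ∀ {q r}   → q ≢ 0ℤ → Live 0ℤ q r
      oldest : ∀ {r}     → r ≢ 0ℤ → Live 0ℤ 0ℤ r

    top : ∀ {z} → z ≢ 0ℤ → c₃ ℤ.* z ≢ 0ℤ
    top = *-≢0 c₃≢0

    carry₂-old : ∀ q → carry₂ 0ℤ q ≡ c₃ ℤ.* q
    carry₂-old q = skip c₂ (c₃ ℤ.* q)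

    carry₁-old : ∀ r → carry₁ 0ℤ 0ℤ r ≡ c₃ ℤ.* r
    carry₁-old r = trans (skip c₁ (carry₂ 0ℤ r)) (carry₂-old r)

    flush : ∀ {p q r} → Live p q r → 1 ≤ L (stream p q r [])
    flush (newest {p} {q} {r} p≢0) =
      nonzero-entry (stream p q r []) (there (there (here refl))) (top p≢0)
    flush (middle {q} {r} q≢0) =
      nonzero-entry (stream 0ℤ q r []) (there (here refl)) (≡-≢0 (carry₂-old q) (top q≢0))
    flush (oldest {r} r≢0) =
      nonzero-entry (stream 0ℤ 0ℤ r []) (here refl) (≡-≢0 (carry₁-old r) (top r≢0))

    read : ∀ x {p q r} → Live p q r → Live x p q ⊎ c₀ ℤ.* x ℤ.+ carry₁ p q r ≢ 0ℤ
    read x w with x ℤ.≟ 0ℤ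
    read x w              | no x≢0   = inj₁ (newest x≢0)
    read _ (newest p≢0)   | yes refl = inj₁ (middle p≢0)
    read _ (middle q≢0)   | yes refl = inj₁ (oldest q≢0)
    read _ (oldest {r} r≢0) | yes refl =
      inj₂ (≡-≢0 (trans (skip c₀ (carry₁ 0ℤ 0ℤ r)) (carry₁-old r)) (top r≢0))

    persist : ∀ {x p q} g → p ≢ 0ℤ → 1 ≤ L (stream x p q g)
    persist {x} g p≢0 with x ℤ.≟ 0ℤ
    ... | no x≢0   = nonzero-stream Live flush read g (newest x≢0)
    ... | yes refl = nonzero-stream Live flush read g (middle p≢0)

  -- For a quadratic padded with c₃ = 0, the same holds for the two newest
  -- window entries, which meet c₂.
  module TopQuadratic (c₃≡0 : c₃ ≡ 0ℤ) (c₂≢0 : c₂ ≢ 0ℤ) where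
    top : ∀ {z} → z ≢ 0ℤ → c₂ ℤ.* z ≢ 0ℤ
    top = *-≢0 c₂≢0

    drop-c₃ : ∀ y z → y ℤ.+ c₃ ℤ.* z ≡ y
    drop-c₃ y z = trans (cong (λ c → y ℤ.+ c ℤ.* z) c₃≡0) (ℤP.+-identityʳ y)

    data Live : ℤ → ℤ → ℤ → Set where
      newest : ∀ {p q r} → p ≢ 0ℤ → Live p q r
      middle : ∀ {q r}   → q ≢ 0ℤ → Live 0ℤ q r

    carry₁-old : ∀ q r → carry₁ 0ℤ q r ≡ c₂ ℤ.* q
    carry₁-old q r = trans (skip c₁ (carry₂ q r)) (drop-c₃ (c₂ ℤ.* q) r)

    flush : ∀ {p q r} → Live p q r → 1 ≤ L (stream p q r [])
    flush (newest {p} {q} {r} p≢0) =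
      nonzero-entry (stream p q r []) (there (here refl)) (≡-≢0 (drop-c₃ (c₂ ℤ.* p) q) (top p≢0))
    flush (middle {q} {r} q≢0) =
      nonzero-entry (stream 0ℤ q r []) (here refl) (≡-≢0 (carry₁-old q r) (top q≢0))

    read : ∀ x {p q r} → Live p q r → Live x p q ⊎ c₀ ℤ.* x ℤ.+ carry₁ p q r ≢ 0ℤ
    read x w with x ℤ.≟ 0ℤ
    read x w            | no x≢0   = inj₁ (newest x≢0)
    read _ (newest p≢0) | yes refl = inj₁ (middle p≢0)
    read _ (middle {q} {r} q≢0) | yes refl =
      inj₂ (≡-≢0 (trans (skip c₀ (carry₁ 0ℤ q r)) (carry₁-old q r)) (top q≢0))

    persist : ∀ {x p q} g → p ≢ 0ℤ → 1 ≤ L (stream x p q g)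
    persist {x} g p≢0 with x ℤ.≟ 0ℤ
    ... | no x≢0   = nonzero-stream Live flush read g (newest x≢0)
    ... | yes refl = nonzero-stream Live flush read g (middle p≢0)

  record SignInvariant : Set₁ where
    field
      Holds     : ℤ → ℤ → ℤ → Set
      start     : ∀ {x} → x ≢ 0ℤ → Holds x 0ℤ 0ℤ
      newest≢0  : ∀ {p q r} → Holds p q r → p ≢ 0ℤ
      flush     : ∀ {p q r} → Holds p q r → 2 ≤ L (stream p q r [])
      advance   : ∀ {x p q r} → Holds p q r → c₀ ℤ.* x ℤ.+ carry₁ p q r ≡ 0ℤ → Holds x p q

  module _ (S : SignInvariant) (persist : ∀ {x p q} g → p ≢ 0ℤ → 1 ≤ L (stream x p q g)) where
    open SignInvariant S

    -- A window of the family emits length ≥ 2: either it emits only zeros and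
    -- stays in the family until it flushes, or it emits a nonzero coefficient
    -- while its newest entry is nonzero, which keeps the rest nonzero.
    two-≤ : ∀ {p q r} g → Holds p q r → 2 ≤ L (stream p q r g)
    two-≤ [] s = flush s
    two-≤ {p} {q} {r} (x ∷ g) s with c₀ ℤ.* x ℤ.+ carry₁ p q r ℤ.≟ 0ℤ
    ... | yes o≡0 = ≤-trans (two-≤ g (advance s o≡0)) (emitted-later p q r x g)
    ... | no o≢0  = +-mono-≤ (abs-pos o≢0) (persist g (newest≢0 s))

    -- The first nonzero coefficient x of g is emitted as c₀x and enters the family.
    sign-theorem : ∀ g → NonZeroPoly g → α₀ + 2 ≤ L (cubic ⊛ g)
    sign-theorem = lower-bound (α₀ + 2) λ x g x≢0 →
      +-mono-≤ (subst (_≤ α₀ * ∣ x ∣) (*-identityʳ α₀) (*-monoʳ-≤ α₀ (abs-pos x≢0))) (two-≤ g (start x≢0))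

dominant-linear-coefficient : ∀ c₀ c₁ c₂ c₃ → ∣ c₀ ∣ + ∣ c₂ ∣ + ∣ c₃ ∣ ≤ ∣ c₁ ∣
  → ∀ g → NonZeroPoly g → L (c₀ ∷ c₁ ∷ c₂ ∷ c₃ ∷ []) ≤ L ((c₀ ∷ c₁ ∷ c₂ ∷ c₃ ∷ []) ⊛ g)
dominant-linear-coefficient c₀ c₁ c₂ c₃ dominates =
  Dominant.theorem (∣ c₁ ∣ ∸ (∣ c₀ ∣ + ∣ c₂ ∣ + ∣ c₃ ∣)) (sym (m+[n∸m]≡n dominates))
  where open Cubic c₀ c₁ c₂ c₃

module Golden where
  open Cubic (ℤ.- + 1) (ℤ.- + 1) (+ 1) 0ℤ

  carry₁-value : ∀ p q r → carry₁ p q r ≡ q ℤ.- p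
  carry₁-value = expand
    where
    expand : ∀ p q r → ℤ.- + 1 ℤ.* p ℤ.+ (+ 1 ℤ.* q ℤ.+ 0ℤ ℤ.* r) ≡ q ℤ.- p
    expand = ℤSolver.solve-∀

  carry₂-value : ∀ p q → carry₂ p q ≡ p
  carry₂-value p q = trans (ℤP.+-identityʳ (+ 1 ℤ.* p)) (ℤP.*-identityˡ p)

  emitted-zero : ∀ {x c} → ℤ.- + 1 ℤ.* x ℤ.+ c ≡ 0ℤ → x ≡ c
  emitted-zero {x} {c} o≡0 =
    trans (solve-x x c) (trans (cong (ℤ._-_ c) o≡0) (ℤP.+-identityʳ c))
    where
    solve-x : ∀ x c → x ≡ c ℤ.- (ℤ.- + 1 ℤ.* x ℤ.+ c)
    solve-x = ℤSolver.solve-∀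

  data Alternating : ℤ → ℤ → ℤ → Set where
    positive : ∀ {p q r} → 0ℤ ℤ.< p → q ℤ.≤ 0ℤ → Alternating p q r
    negative : ∀ {p q r} → p ℤ.< 0ℤ → 0ℤ ℤ.≤ q → Alternating p q r

  newest≢0 : ∀ {p q r} → Alternating p q r → p ≢ 0ℤ
  newest≢0 (positive 0<p _) = pos⇒≢0 0<p
  newest≢0 (negative p<0 _) = neg⇒≢0 p<0

  carry-alternates : ∀ {p q r} → Alternating p q r → Alternating (carry₁ p q r) p q
  carry-alternates {p} {q} {r} (positive 0<p q≤0) =
    negative (subst (ℤ._< 0ℤ) (sym (carry₁-value p q r)) (ℤP.+-mono-≤-< q≤0 (ℤP.neg-mono-< 0<p)))
             (ℤP.<⇒≤ 0<p)
  carry-alternates {p} {q} {r} (negative p<0 0≤q) =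
    positive (subst (0ℤ ℤ.<_) (sym (carry₁-value p q r)) (ℤP.+-mono-≤-< 0≤q (ℤP.neg-mono-< p<0)))
             (ℤP.<⇒≤ p<0)

  invariant : SignInvariant
  invariant = record
    { Holds    = Alternating
    ; start    = start
    ; newest≢0 = newest≢0
    ; flush    = λ {p} {q} s → +-mono-≤ (abs-pos (newest≢0 (carry-alternates s)))
                   (nonzero-entry (carry₂ p q ∷ 0ℤ ℤ.* p ∷ []) (here refl)
                     (≡-≢0 (carry₂-value p q) (newest≢0 s)))
    ; advance  = λ s o≡0 → subst (λ x → Alternating x _ _) (sym (emitted-zero o≡0)) (carry-alternates s)
    }
    where
    start : ∀ {x} → x ≢ 0ℤ → Alternating x 0ℤ 0ℤ
    start {x} x≢0 with ℤP.<-cmp x 0ℤ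
    ... | tri< x<0 _ _ = negative x<0 ℤP.≤-refl
    ... | tri≈ _ x≡0 _ = ⊥-elim (x≢0 x≡0)
    ... | tri> _ _ 0<x = positive 0<x ℤP.≤-refl

  theorem : ∀ g → NonZeroPoly g → L cubic ≤ L (cubic ⊛ g)
  theorem = sign-theorem invariant (TopQuadratic.persist refl (λ ()))

module Trinomial where
  open Cubic (+ 1) (+ 1) 0ℤ (+ 1)

  carry₁-value : ∀ p q r → carry₁ p q r ≡ p ℤ.+ r
  carry₁-value = expand
    where
    expand : ∀ p q r → + 1 ℤ.* p ℤ.+ (0ℤ ℤ.* q ℤ.+ + 1 ℤ.* r) ≡ p ℤ.+ r
    expand = ℤSolver.solve-∀

  emitted-zero : ∀ {x c} → + 1 ℤ.* x ℤ.+ c ≡ 0ℤ → x ≡ ℤ.- c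
  emitted-zero {x} {c} o≡0 =
    trans (solve-x x c) (trans (cong (ℤ._- c) o≡0) (ℤP.+-identityˡ (ℤ.- c)))
    where
    solve-x : ∀ x c → x ≡ (+ 1 ℤ.* x ℤ.+ c) ℤ.- c
    solve-x = ℤSolver.solve-∀

  data Alternating : ℤ → ℤ → ℤ → Set where
    positive : ∀ {p q r} → 0ℤ ℤ.< p → q ℤ.≤ 0ℤ → 0ℤ ℤ.≤ r → Alternating p q r
    negative : ∀ {p q r} → p ℤ.< 0ℤ → 0ℤ ℤ.≤ q → r ℤ.≤ 0ℤ → Alternating p q r

  newest≢0 : ∀ {p q r} → Alternating p q r → p ≢ 0ℤ
  newest≢0 (positive 0<p _ _) = pos⇒≢0 0<p
  newest≢0 (negative p<0 _ _) = neg⇒≢0 p<0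

  carry-alternates : ∀ {p q r} → Alternating p q r → Alternating (ℤ.- carry₁ p q r) p q
  carry-alternates {p} {q} {r} (positive 0<p q≤0 0≤r) =
    negative (ℤP.neg-mono-< (subst (0ℤ ℤ.<_) (sym (carry₁-value p q r)) (ℤP.+-mono-<-≤ 0<p 0≤r)))
             (ℤP.<⇒≤ 0<p) q≤0
  carry-alternates {p} {q} {r} (negative p<0 0≤q r≤0) =
    positive (ℤP.neg-mono-< (subst (ℤ._< 0ℤ) (sym (carry₁-value p q r)) (ℤP.+-mono-<-≤ p<0 r≤0)))
             (ℤP.<⇒≤ p<0) 0≤q

  carry-nonzero : ∀ {p q r} → Alternating p q r → carry₁ p q r ≢ 0ℤ
  carry-nonzero s c≡0 = newest≢0 (carry-alternates s) (cong ℤ.-_ c≡0)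

  invariant : SignInvariant
  invariant = record
    { Holds    = Alternating
    ; start    = start
    ; newest≢0 = newest≢0
    ; flush    = λ {p} {q} s → +-mono-≤ (abs-pos (carry-nonzero s))
                   (nonzero-entry (carry₂ p q ∷ + 1 ℤ.* p ∷ []) (there (here refl))
                     (≡-≢0 (ℤP.*-identityˡ p) (newest≢0 s)))
    ; advance  = λ s o≡0 → subst (λ x → Alternating x _ _) (sym (emitted-zero o≡0)) (carry-alternates s)
    }
    where
    start : ∀ {x} → x ≢ 0ℤ → Alternating x 0ℤ 0ℤ
    start {x} x≢0 with ℤP.<-cmp x 0ℤ
    ... | tri< x<0 _ _ = negative x<0 ℤP.≤-refl ℤP.≤-refl
    ... | tri≈ _ x≡0 _ = ⊥-elim (x≢0 x≡0)
    ... | tri> _ _ 0<x = positive 0<x ℤP.≤-refl ℤP.≤-refl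

  theorem : ∀ g → NonZeroPoly g → L cubic ≤ L (cubic ⊛ g)
  theorem = sign-theorem invariant (TopCubic.persist (λ ()))

quadratic-case : ∀ a → 1 ≤ a → ∀ g → NonZeroPoly g → L (f₁ a) ≤ L ((f₁ a ++ 0ℤ ∷ []) ⊛ g)
quadratic-case 1             _ = Golden.theorem
quadratic-case (suc (suc b)) _ =
  dominant-linear-coefficient (ℤ.- + 1) (ℤ.- + suc (suc b)) (+ 1) 0ℤ (s≤s (s≤s z≤n))

cubic-case : ∀ a → 1 ≤ a → ∀ g → NonZeroPoly g → L (f₂ a) ≤ L (f₂ a ⊛ g)
cubic-case 1             _ = Trinomial.theorem
cubic-case (suc (suc b)) _ =
  dominant-linear-coefficient (+ 1) (+ suc (suc b)) 0ℤ (+ 1) (s≤s (s≤s z≤n))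

lemma5 : (a : ℕ) → 1 ≤ a → (f : Poly)
         → (f ≡ f₁ a ⊎ f ≡ f₂ a ⊎ (f ≡ f₃ a × a ≥ 3))
         → (g : Poly) → NonZeroPoly g → L (f ⊛ g) ≥ L f
lemma5 a 1≤a f (inj₁ refl) g g≢0 =
  subst (L (f₁ a) ≤_) (L-pad (f₁ a) g) (quadratic-case a 1≤a g g≢0)
lemma5 a 1≤a f (inj₂ (inj₁ refl)) g g≢0 = cubic-case a 1≤a g g≢0
lemma5 a _ f (inj₂ (inj₂ (refl , 3≤a))) g g≢0 =
  dominant-linear-coefficient (+ 1) (+ a) (+ 1) (+ 1) 3≤a g g≢0
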